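{- The following sequent rules are sound (validity of all premisses implies validity of the conclusion), where $\Gamma,\Delta$ are arbitrary multisets of compound diagrams and $p_c$ denotes the positive literal for contour $c$: (RedL) from $d\setminus c_1,\dots,d\setminus c_k,\Gamma\Rightarrow\Delta$ infer $d,\Gamma\Rightarrow\Delta$; (RedR) from $\Gamma\Rightarrow\Delta,d\setminus c_i$ for all $1\le i\le k$ infer $\Gamma\Rightarrow\Delta,d$; where $d=(L,Z)$ is a pure Euler diagram such that for each $z\in M(d)$ there is $\ell\in L$ with $\mathrm{adj}(z,\ell)\in M(d)$, and $\{c_1,\dots,c_k\}\subseteq L$ is the maximal set of contours with $M(d\setminus c_i)\neq\emptyset$ for every $i$; (MSepL) from $d_1,d_2,\Gamma\Rightarrow\Delta$ infer $d,\Gamma\Rightarrow\Delta$; (MSepR) from $\Gamma\Rightarrow\Delta,d_1$ and $\Gamma\Rightarrow\Delta,d_2$ infer $\Gamma\Rightarrow\Delta,d$; where $d=(L,Z)$ is a pure Euler diagram with $|M(d)|>1$ and $d_1=(L,Z_1)$, $d_2=(L,Z_2)$ are pure Euler diagrams with $Z_1\cap Z_2=Z$; (ImpDecL) from $d,\Gamma\Rightarrow p_{n_i}$ for all $1\le i\le k$ and $p_{o_j},\Gamma\Rightarrow\Delta$ for all $1\le j\le l$ infer $d,\Gamma\Rightarrow\Delta$; (ImpDecR) from $\Gamma,p_{n_1},\dots,p_{n_k}\Rightarrow p_{o_1},\dots,p_{o_l}$ infer $\Gamma\Rightarrow\Delta,d$; where in ImpDecL/ImpDecR, $d$ is a pure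 Euler diagram with exactly one missing zone $z=(\{n_1,\dots,n_k\},\{o_1,\dots,o_l\})$.
   Context: Fix a countable set $\mathcal V$ of propositional variables (contours). A Heyting algebra $(H,\vee,\wedge,\to,0,1)$ is a bounded distributive lattice with relative pseudo-complement $\to$ ($c\wedge a\le b$ iff $c\le a\to b$); $-a:=a\to0$; empty meets are $1$, empty joins $0$. A valuation is a map $v:\mathcal V\to H$. A zone for a finite $L\subset\mathcal V$ is a pair $z=(z^{in},z^{out})$ of disjoint subsets of $L$ with union $L$; $\mathcal Z(L)$ is the set of all zones for $L$. Its zone semantics is $v(z)=\bigwedge_{c\in z^{in}}v(c)\wedge\bigwedge_{c\in z^{out}}-v(c)$ and its missing-zone semantics is $m_v(z)=\bigwedge_{c\in z^{in}}v(c)\to\bigvee_{c\in z^{out}}v(c)$. A pure Euler diagram is $d=(L,Z)$ with $Z\subseteq\mathcal Z(L)$; $M(d)=\mathcal Z(L)\setminus Z$ (missing zones); $v(d)=\bigwedge_{z\in M(d)}m_v(z)$. For $c\in L$: $\mathrm{adj}(z,c)$ is $z$ with $c$ moved from $z^{out}$ to $z^{in}$ or vice versa; $z\setminus c=(z^{in}\setminus\{c\},z^{out}\setminus\{c\})$; $d\setminus c=(L\setminus\{c\},\{z\setminus c\mid z\in Z\})$. A Venn diagram is $(L,\mathcal Z(L),S)$ with $S\subseteq\mathcal Z(L)$ and semantics $\bigvee_{z\in S}v(z)$; the positive literal $p_c$ is the Venn diagram $(\{c\},\mathcal Z(\{c\}),\{(\{c\},\emptyset)\})$, so $v(p_c)=v(c)$.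 An Euler–Venn diagram $(L,Z,S)$, $S\subseteq Z$, has semantics $v((L,Z))\to v((L,\mathcal Z(L),S))$. Compound diagrams: $D::=d\mid D\wedge D\mid D\vee D\mid D\to D$ ($d$ unitary) with the Heyting operations as semantics. A sequent $\Gamma\Rightarrow\Delta$ consists of finite multisets of compound diagrams; it is valid iff $\bigwedge_{D\in\Gamma}v(D)\le\bigvee_{E\in\Delta}v(E)$ for every valuation in every Heyting algebra. A rule is sound if validity of its premisses implies validity of its conclusion. -}

module Defs where

open import Level using (Level; _⊔_) renaming (suc to lsuc)
open import Data.Nat using (ℕ; zero; suc)
open import Data.Bool using (Bool; true; false; not) renaming (_∨_ to _or_)
open import Data.Fin using (Fin; zero; suc; punchIn)
open import Data.Fin.Properties using (punchIn-injective)
open import Data.Vec using (Vec; []; _∷_; lookup; removeAt; insertAt; updateAt)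
open import Data.List using (List; []; _∷_; map; _++_; foldr; filterᵇ)
open import Relation.Binary.PropositionalEquality using (_≡_; refl; cong; sym; trans)
open import Relation.Binary.Lattice using (HeytingAlgebra)

-- Contours: the countable set 𝒱 of contours is ℕ.
-- A finite contour set L ⊂ 𝒱 is a duplicate-free vector of labels
-- (the order of the vector is irrelevant bookkeeping).

Contour : Set
Contour = ℕ

Distinct : ∀ {n} → Vec Contour n → Set
Distinct {n} L = (i j : Fin n) → lookup L i ≡ lookup L j → i ≡ j

-- A zone for L = (c₁ … cₙ) is a bit vector z; z^in = {cᵢ | zᵢ = true},
-- z^out = {cᵢ | zᵢ = false}.  So Zone n ≅ 𝒵(L).
Zone : ℕ → Set
Zone n = Vec Bool n

allZones : (n : ℕ) → List (Zone n)
allZones zero    = [] ∷ []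
allZones (suc n) = map (true ∷_) (allZones n) ++ map (false ∷_) (allZones n)

adj : ∀ {n} → Zone n → Fin n → Zone n
adj z i = updateAt z i not

-- Pure Euler diagrams d = (L, Z), Z ⊆ 𝒵(L) given by its (decidable)
-- characteristic function.

record PED : Set where
  constructor ped
  field
    n        : ℕ
    labels   : Vec Contour n
    distinct : Distinct labels
    Z        : Zone n → Bool

missing : (d : PED) → List (Zone (PED.n d))
missing d = filterᵇ (λ z → not (PED.Z d z)) (allZones (PED.n d))

inLabels : ∀ {n} → Zone n → Vec Contour n → List Contour
inLabels []          []       = []
inLabels (true ∷ z)  (c ∷ L)  = c ∷ inLabels z L
inLabels (false ∷ z) (c ∷ L)  = inLabels z L

outLabels : ∀ {n} → Zone n → Vec Contour n → List Contour
outLabels []          []       = []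
outLabels (true ∷ z)  (c ∷ L)  = outLabels z L
outLabels (false ∷ z) (c ∷ L)  = c ∷ outLabels z L

lookup-removeAt : ∀ {A : Set} {m} (xs : Vec A (suc m)) (i : Fin (suc m)) (j : Fin m) →
                  lookup (removeAt xs i) j ≡ lookup xs (punchIn i j)
lookup-removeAt (x ∷ xs)     zero    j       = refl
lookup-removeAt (x ∷ y ∷ xs) (suc i) zero    = refl
lookup-removeAt (x ∷ y ∷ xs) (suc i) (suc j) = lookup-removeAt (y ∷ xs) i j

removeAt-distinct : ∀ {m} (L : Vec Contour (suc m)) → Distinct L → (i : Fin (suc m)) →
                    Distinct (removeAt L i)
removeAt-distinct L dL i j k eq =
  punchIn-injective i j k
    (dL (punchIn i j) (punchIn i k)
        (trans (sym (lookup-removeAt L i j)) (trans eq (lookup-removeAt L i k))))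

-- L ∖ {c}, zones {z ∖ c | z ∈ Z}: w is a zone of d ∖ c iff one of its two
-- extensions (c in / c out) is a zone of d.
_∖_ : (d : PED) → Fin (PED.n d) → PED
ped (suc m) L dL Z ∖ i =
  ped m (removeAt L i) (removeAt-distinct L dL i)
      (λ w → Z (insertAt w i true) or Z (insertAt w i false))

data Unitary : Set where
  euler     : PED → Unitary
  venn      : (n : ℕ) (L : Vec Contour n) → Distinct L → (S : Zone n → Bool) → Unitary
  eulerVenn : (d : PED) (S : Zone (PED.n d) → Bool) →
              (∀ z → S z ≡ true → PED.Z d z ≡ true) → Unitary

infixr 6 _∧ᶜ_ _∨ᶜ_
infixr 5 _⇒ᶜ_

data CD : Set where
  unit  : Unitary → CD
  _∧ᶜ_  : CD → CD → CD
  _∨ᶜ_  : CD → CD → CD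
  _⇒ᶜ_  : CD → CD → CD

⌜_⌝ : PED → CD
⌜ d ⌝ = unit (euler d)

-- positive literal p_c = ({c}, 𝒵({c}), {({c}, ∅)})
distinct₁ : (c : Contour) → Distinct (c ∷ [])
distinct₁ c zero zero _ = refl

litS : Zone 1 → Bool
litS (b ∷ []) = b

lit : Contour → CD
lit c = unit (venn 1 (c ∷ []) (distinct₁ c) litS)

module Sem {a ℓ₁ ℓ₂} (H : HeytingAlgebra a ℓ₁ ℓ₂)
           (v : Contour → HeytingAlgebra.Carrier H) where
  open HeytingAlgebra H

  neg : Carrier → Carrier
  neg x = x ⇨ ⊥

  ⋀ : List Carrier → Carrier
  ⋀ = foldr _∧_ ⊤

  ⋁ : List Carrier → Carrier
  ⋁ = foldr _∨_ ⊥

  zoneSem : ∀ {n} → Zone n → Vec Contour n → Carrier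
  zoneSem z L = ⋀ (map v (inLabels z L)) ∧ ⋀ (map (λ c → neg (v c)) (outLabels z L))

  missSem : ∀ {n} → Zone n → Vec Contour n → Carrier
  missSem z L = ⋀ (map v (inLabels z L)) ⇨ ⋁ (map v (outLabels z L))

  pedSem : PED → Carrier
  pedSem d = ⋀ (map (λ z → missSem z (PED.labels d)) (missing d))

  vennSem : ∀ n → Vec Contour n → (Zone n → Bool) → Carrier
  vennSem n L S = ⋁ (map (λ z → zoneSem z L) (filterᵇ S (allZones n)))

  unitSem : Unitary → Carrier
  unitSem (euler d)           = pedSem d
  unitSem (venn n L _ S)      = vennSem n L S
  unitSem (eulerVenn d S _)   = pedSem d ⇨ vennSem (PED.n d) (PED.labels d) S

  cdSem : CD → Carrier
  cdSem (unit u)  = unitSem u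
  cdSem (D ∧ᶜ E)  = cdSem D ∧ cdSem E
  cdSem (D ∨ᶜ E)  = cdSem D ∨ cdSem E
  cdSem (D ⇒ᶜ E)  = cdSem D ⇨ cdSem E

-- Validity of a sequent Γ ⇒ Δ (multisets as lists), relative to the class
-- of all Heyting algebras at universe levels a, ℓ₁, ℓ₂.

Valid : (a ℓ₁ ℓ₂ : Level) → List CD → List CD → Set (lsuc (a ⊔ ℓ₁ ⊔ ℓ₂))
Valid a ℓ₁ ℓ₂ Γ Δ =
  (H : HeytingAlgebra a ℓ₁ ℓ₂) (v : Contour → HeytingAlgebra.Carrier H) →
  HeytingAlgebra._≤_ H (Sem.⋀ H v (map (Sem.cdSem H v) Γ))
                       (Sem.⋁ H v (map (Sem.cdSem H v) Δ))

-- A pure Euler diagram denotes the meet of the implications ⋀ v(z^in) ⇨ ⋁ v(z^out) over its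
-- missing zones z, so every rule reduces to an inequality between such meets in a Heyting algebra.
-- The reduction rules rest on resolution on a contour c: a zone w of d ∖ c is missing exactly
-- when both its extensions are, and with A = ⋀ v(w^in), O = ⋁ v(w^out) we have
-- (c ∧ A ⇨ O) ∧ (A ⇨ c ∨ O) ≤ A ⇨ O, so d entails every d ∖ c.  Conversely A ⇨ O entails both
-- extensions, so a missing zone z of d whose neighbour adj(z, c) is also missing is entailed by
-- d ∖ c, and maximality puts such c among the cᵢ.
-- Separation holds because M(d) = M(d₁) ∪ M(d₂), and a diagram with the single missing zone
-- ({n₁ … nₖ}, {o₁ … oₗ}) is just the implication ⋀ v(nᵢ) ⇨ ⋁ v(oⱼ).

module Submission where

open import Defs
open import Level using (Level)
open import Data.Nat using (_<_; suc)
open import Data.Bool using (Bool; true; false; not; _∧_; _≟_) renaming (_∨_ to _or_)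
open import Data.Bool.Properties using (∨-conicalˡ; ∨-conicalʳ; ∧-zeroʳ; ¬-not; T-not-≡)
open import Data.Fin using (Fin; zero; suc)
open import Data.Product using (Σ; _×_; _,_; proj₂)
open import Data.Sum using (_⊎_; inj₁; inj₂; [_,_]′)
open import Data.List using (List; []; _∷_; _++_; [_]; _∷ʳ_; map; length)
open import Data.List.Properties using (map-∘)
open import Data.List.Membership.Propositional using (_∈_)
open import Data.List.Membership.Propositional.Properties
  using (∈-map⁺; ∈-++⁺ˡ; ∈-++⁺ʳ; ∈-++⁻; ∈-filter⁺; ∈-filter⁻)
open import Data.List.Relation.Unary.Any using (here; there)
open import Data.List.Relation.Unary.Any.Properties using (¬Any[])
open import Data.List.Relation.Unary.Unique.Propositional using (Unique)
open import Data.List.Relation.Binary.Subset.Propositional using (_⊆_)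
open import Data.List.Relation.Binary.Subset.Propositional.Properties
  using (⊆-reflexive; ⊆-reflexive-↭)
open import Data.List.Relation.Binary.Permutation.Propositional
  using (_↭_; ↭-refl; ↭-prep; ↭-swap; ↭-trans; ↭-sym)
open import Data.Vec using (Vec; []; _∷_; lookup; removeAt; insertAt)
open import Data.Vec.Properties using (insertAt-removeAt)
open import Function.Base using (_∘_)
open import Function.Bundles using (_⇔_; Equivalence)
open import Relation.Binary.PropositionalEquality using (_≡_; _≢_; refl; sym; trans; cong; cong₂; subst)
open import Relation.Binary.Lattice using (HeytingAlgebra)
open import Relation.Nullary using (yes; no)
open import Relation.Nullary.Decidable using (T?)

allZones-complete : ∀ {n} (z : Zone n) → z ∈ allZones n
allZones-complete []          = here refl
allZones-complete (true ∷ z)  = ∈-++⁺ˡ (∈-map⁺ (true ∷_) (allZones-complete z))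
allZones-complete {suc n} (false ∷ z) =
  ∈-++⁺ʳ (map (true ∷_) (allZones n)) (∈-map⁺ (false ∷_) (allZones-complete z))

∈-missing⁺ : (d : PED) {z : Zone (PED.n d)} → PED.Z d z ≡ false → z ∈ missing d
∈-missing⁺ d zf = ∈-filter⁺ (T? ∘ not ∘ PED.Z d) (allZones-complete _) (Equivalence.from T-not-≡ zf)

∈-missing⁻ : (d : PED) {z : Zone (PED.n d)} → z ∈ missing d → PED.Z d z ≡ false
∈-missing⁻ d z∈ =
  Equivalence.to T-not-≡ (proj₂ (∈-filter⁻ (T? ∘ not ∘ PED.Z d) {xs = allZones (PED.n d)} z∈))

insertAt-removeAt-not : ∀ {m} (z : Zone (suc m)) (i : Fin (suc m)) →
                        insertAt (removeAt z i) i (not (lookup z i)) ≡ adj z i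
insertAt-removeAt-not (b ∷ z)      zero    = refl
insertAt-removeAt-not (b ∷ b′ ∷ z) (suc i) = cong (b ∷_) (insertAt-removeAt-not (b′ ∷ z) i)

inLabels-insertAt-true : ∀ {m} (w : Zone m) (L : Vec Contour (suc m)) (i : Fin (suc m)) →
                         inLabels (insertAt w i true) L ↭ lookup L i ∷ inLabels w (removeAt L i)
inLabels-insertAt-true w           (c ∷ L)      zero    = ↭-refl
inLabels-insertAt-true (true ∷ w)  (c ∷ c′ ∷ L) (suc i) =
  ↭-trans (↭-prep c (inLabels-insertAt-true w (c′ ∷ L) i)) (↭-swap c _ ↭-refl)
inLabels-insertAt-true (false ∷ w) (c ∷ c′ ∷ L) (suc i) = inLabels-insertAt-true w (c′ ∷ L) i

inLabels-insertAt-false : ∀ {m} (w : Zone m) (L : Vec Contour (suc m)) (i : Fin (suc m)) →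
                          inLabels (insertAt w i false) L ≡ inLabels w (removeAt L i)
inLabels-insertAt-false w           (c ∷ L)      zero    = refl
inLabels-insertAt-false (true ∷ w)  (c ∷ c′ ∷ L) (suc i) =
  cong (c ∷_) (inLabels-insertAt-false w (c′ ∷ L) i)
inLabels-insertAt-false (false ∷ w) (c ∷ c′ ∷ L) (suc i) = inLabels-insertAt-false w (c′ ∷ L) i

outLabels-insertAt-true : ∀ {m} (w : Zone m) (L : Vec Contour (suc m)) (i : Fin (suc m)) →
                          outLabels (insertAt w i true) L ≡ outLabels w (removeAt L i)
outLabels-insertAt-true w           (c ∷ L)      zero    = refl
outLabels-insertAt-true (true ∷ w)  (c ∷ c′ ∷ L) (suc i) = outLabels-insertAt-true w (c′ ∷ L) i
outLabels-insertAt-true (false ∷ w) (c ∷ c′ ∷ L) (suc i) =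
  cong (c ∷_) (outLabels-insertAt-true w (c′ ∷ L) i)

outLabels-insertAt-false : ∀ {m} (w : Zone m) (L : Vec Contour (suc m)) (i : Fin (suc m)) →
                           outLabels (insertAt w i false) L ↭ lookup L i ∷ outLabels w (removeAt L i)
outLabels-insertAt-false w           (c ∷ L)      zero    = ↭-refl
outLabels-insertAt-false (true ∷ w)  (c ∷ c′ ∷ L) (suc i) = outLabels-insertAt-false w (c′ ∷ L) i
outLabels-insertAt-false (false ∷ w) (c ∷ c′ ∷ L) (suc i) =
  ↭-trans (↭-prep c (outLabels-insertAt-false w (c′ ∷ L) i)) (↭-swap c _ ↭-refl)

removeAt-missing : ∀ {m} {L : Vec Contour (suc m)} {dL : Distinct L} {Z : Zone (suc m) → Bool}
                   {z : Zone (suc m)} {i : Fin (suc m)} →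
                   Z z ≡ false → Z (adj z i) ≡ false →
                   PED.Z (ped (suc m) L dL Z ∖ i) (removeAt z i) ≡ false
removeAt-missing {Z = Z} {z} {i} zf adjf =
  cong₂ _or_ (extension-missing true) (extension-missing false)
  where
    extension-missing : ∀ b → Z (insertAt (removeAt z i) i b) ≡ false
    extension-missing b with b ≟ lookup z i
    ... | yes refl = subst (λ z′ → Z z′ ≡ false) (sym (insertAt-removeAt z i)) zf
    ... | no  b≢   rewrite ¬-not b≢ =
      subst (λ z′ → Z z′ ≡ false) (sym (insertAt-removeAt-not z i)) adjf

missing-∖-nonempty : (d : PED) {z : Zone (PED.n d)} {i : Fin (PED.n d)} →
                     PED.Z d z ≡ false → PED.Z d (adj z i) ≡ false → missing (d ∖ i) ≢ []
missing-∖-nonempty d@(ped (suc m) L dL Z) {z} {i} zf adjf eq =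
  ¬Any[] (subst (removeAt z i ∈_) eq
    (∈-missing⁺ (d ∖ i) (removeAt-missing {L = L} {dL} {Z} zf adjf)))

∧≡false⇒ : ∀ {x y} → x ∧ y ≡ false → x ≡ false ⊎ y ≡ false
∧≡false⇒ {false} _   = inj₁ refl
∧≡false⇒ {true}  y≡f = inj₂ y≡f

module Soundness {a ℓ₁ ℓ₂} (H : HeytingAlgebra a ℓ₁ ℓ₂) (v : Contour → HeytingAlgebra.Carrier H)
  where

  open HeytingAlgebra H
    renaming (_∧_ to _⊓_; _∨_ to _⊔_; refl to ≤-refl; trans to ≤-trans)
  open import Relation.Binary.Lattice.Properties.HeytingAlgebra H
    using (⇨-eval; ⇨-relax; ∧-distribˡ-∨-≤; distributiveLattice)
  open import Relation.Binary.Lattice.Properties.DistributiveLattice distributiveLattice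
    using (∨-distribˡ-∧)
  open import Relation.Binary.Lattice.Properties.MeetSemilattice meetSemilattice
    using (∧-monotonic)
  open import Relation.Binary.Lattice.Properties.JoinSemilattice joinSemilattice
    using (∨-monotonic)
  open import Relation.Binary.Reasoning.PartialOrder poset
  open Sem H v

  ⇨-resolve : ∀ {x y z} → (x ⊓ y ⇨ z) ⊓ (y ⇨ x ⊔ z) ≤ y ⇨ z
  ⇨-resolve {x} {y} {z} = transpose-⇨ (begin
    (P ⊓ Q) ⊓ y                ≤⟨ ∧-greatest (∧-monotonic (x∧y≤x _ _) ≤-refl)
                                             (≤-trans (∧-monotonic (x∧y≤y _ _) ≤-refl) ⇨-eval) ⟩
    (P ⊓ y) ⊓ (x ⊔ z)          ≤⟨ ∧-distribˡ-∨-≤ _ _ _ ⟩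
    (P ⊓ y) ⊓ x ⊔ (P ⊓ y) ⊓ z  ≤⟨ ∨-least (≤-trans regroup ⇨-eval) (x∧y≤y _ _) ⟩
    z                          ∎)
    where
      P = x ⊓ y ⇨ z
      Q = y ⇨ x ⊔ z
      regroup : (P ⊓ y) ⊓ x ≤ P ⊓ (x ⊓ y)
      regroup = ∧-greatest (≤-trans (x∧y≤x _ _) (x∧y≤x _ _))
                           (∧-greatest (x∧y≤y _ _) (≤-trans (x∧y≤x _ _) (x∧y≤y _ _)))

  module _ {A : Set} (f : A → Carrier) where

    ⋀-lowerBound : ∀ {x xs} → x ∈ xs → ⋀ (map f xs) ≤ f x
    ⋀-lowerBound (here refl) = x∧y≤x _ _
    ⋀-lowerBound (there x∈)  = ≤-trans (x∧y≤y _ _) (⋀-lowerBound x∈)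

    ⋀-greatest : ∀ {y} xs → (∀ {x} → x ∈ xs → y ≤ f x) → y ≤ ⋀ (map f xs)
    ⋀-greatest []       _ = maximum _
    ⋀-greatest (x ∷ xs) h = ∧-greatest (h (here refl)) (⋀-greatest xs (h ∘ there))

    ⋀-anti-⊆ : ∀ {xs ys} → ys ⊆ xs → ⋀ (map f xs) ≤ ⋀ (map f ys)
    ⋀-anti-⊆ {ys = ys} ys⊆xs = ⋀-greatest ys (⋀-lowerBound ∘ ys⊆xs)

    ⋀-++⁺ : ∀ {y} xs {ys} → y ≤ ⋀ (map f xs) → y ≤ ⋀ (map f ys) → y ≤ ⋀ (map f (xs ++ ys))
    ⋀-++⁺ []       _    y≤ys = y≤ys
    ⋀-++⁺ (x ∷ xs) y≤xs y≤ys =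
      ∧-greatest (≤-trans y≤xs (x∧y≤x _ _)) (⋀-++⁺ xs (≤-trans y≤xs (x∧y≤y _ _)) y≤ys)

    ⊔-⋀-greatest : ∀ {y z} xs → (∀ {x} → x ∈ xs → y ≤ z ⊔ f x) → y ≤ z ⊔ ⋀ (map f xs)
    ⊔-⋀-greatest {y} []       _ = ≤-trans (maximum y) (y≤x∨y _ _)
    ⊔-⋀-greatest {y} {z} (x ∷ xs) h = begin
      y                                  ≤⟨ ∧-greatest (h (here refl)) (⊔-⋀-greatest xs (h ∘ there)) ⟩
      (z ⊔ f x) ⊓ (z ⊔ ⋀ (map f xs))     ≈⟨ ∨-distribˡ-∧ _ _ _ ⟨
      z ⊔ (f x ⊓ ⋀ (map f xs))           ∎

    ⋁-upperBound : ∀ {x xs} → x ∈ xs → f x ≤ ⋁ (map f xs)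
    ⋁-upperBound (here refl) = x≤x∨y _ _
    ⋁-upperBound (there x∈)  = ≤-trans (⋁-upperBound x∈) (y≤x∨y _ _)

    ⋁-least : ∀ {y} xs → (∀ {x} → x ∈ xs → f x ≤ y) → ⋁ (map f xs) ≤ y
    ⋁-least []       _ = minimum _
    ⋁-least (x ∷ xs) h = ∨-least (h (here refl)) (⋁-least xs (h ∘ there))

    ⋁-mono-⊆ : ∀ {xs ys} → xs ⊆ ys → ⋁ (map f xs) ≤ ⋁ (map f ys)
    ⋁-mono-⊆ {xs} xs⊆ys = ⋁-least xs (⋁-upperBound ∘ xs⊆ys)

    ⋁-∷ʳ-≤ : ∀ xs {y} → ⋁ (map f (xs ∷ʳ y)) ≤ ⋁ (map f xs) ⊔ f y
    ⋁-∷ʳ-≤ xs {y} = ⋁-least (xs ∷ʳ y) (λ x∈ → [ in-xs , in-[y] ]′ (∈-++⁻ xs x∈))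
      where
        in-xs : ∀ {x} → x ∈ xs → f x ≤ ⋁ (map f xs) ⊔ f y
        in-xs x∈ = ≤-trans (⋁-upperBound x∈) (x≤x∨y _ _)
        in-[y] : ∀ {x} → x ∈ [ y ] → f x ≤ ⋁ (map f xs) ⊔ f y
        in-[y] (here refl) = y≤x∨y _ _

    ⋁-∷ʳ-≥ : ∀ xs {y} → ⋁ (map f xs) ⊔ f y ≤ ⋁ (map f (xs ∷ʳ y))
    ⋁-∷ʳ-≥ xs =
      ∨-least (⋁-least xs (⋁-upperBound ∘ ∈-++⁺ˡ)) (⋁-upperBound (∈-++⁺ʳ xs (here refl)))

  lit-≤ : ∀ c → cdSem (lit c) ≤ v c
  lit-≤ c = ∨-least (≤-trans (x∧y≤x _ _) (x∧y≤x _ _)) (minimum _)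

  lit-≥ : ∀ c → v c ≤ cdSem (lit c)
  lit-≥ c = ≤-trans (∧-greatest (∧-greatest ≤-refl (maximum _)) (maximum _)) (x≤x∨y _ _)

  ⋀-lits-≥ : ∀ cs → ⋀ (map v cs) ≤ ⋀ (map cdSem (map lit cs))
  ⋀-lits-≥ cs = subst (λ ys → ⋀ (map v cs) ≤ ⋀ ys) (map-∘ cs)
    (⋀-greatest (cdSem ∘ lit) cs (λ c∈ → ≤-trans (⋀-lowerBound v c∈) (lit-≥ _)))

  ⋁-lits-≤ : ∀ cs → ⋁ (map cdSem (map lit cs)) ≤ ⋁ (map v cs)
  ⋁-lits-≤ cs = subst (λ ys → ⋁ ys ≤ ⋁ (map v cs)) (map-∘ cs)
    (⋁-least (cdSem ∘ lit) cs (λ c∈ → ≤-trans (lit-≤ _) (⋁-upperBound v c∈)))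

  missSem-resolve : ∀ {m} (w : Zone m) (L : Vec Contour (suc m)) (i : Fin (suc m)) →
                    missSem (insertAt w i true) L ⊓ missSem (insertAt w i false) L ≤
                      missSem w (removeAt L i)
  missSem-resolve w L i = begin
    missSem (insertAt w i true) L ⊓ missSem (insertAt w i false) L
      ≤⟨ ∧-monotonic (⇨-relax (⋀-anti-⊆ v (⊆-reflexive-↭ (inLabels-insertAt-true w L i)))
                              (⋁-mono-⊆ v (⊆-reflexive (outLabels-insertAt-true w L i))))
                     (⇨-relax (⋀-anti-⊆ v (⊆-reflexive (inLabels-insertAt-false w L i)))
                              (⋁-mono-⊆ v (⊆-reflexive-↭ (outLabels-insertAt-false w L i)))) ⟩
    (v (lookup L i) ⊓ In ⇨ Out) ⊓ (In ⇨ v (lookup L i) ⊔ Out)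
      ≤⟨ ⇨-resolve ⟩
    In ⇨ Out
      ∎
    where
      In  = ⋀ (map v (inLabels w (removeAt L i)))
      Out = ⋁ (map v (outLabels w (removeAt L i)))

  missSem-removeAt-≤ : ∀ {m} (w : Zone m) (L : Vec Contour (suc m)) (i : Fin (suc m)) b →
                       missSem w (removeAt L i) ≤ missSem (insertAt w i b) L
  missSem-removeAt-≤ w L i true =
    ⇨-relax (⋀-anti-⊆ v (⊆-reflexive-↭ (↭-sym (inLabels-insertAt-true w L i)) ∘ there))
            (⋁-mono-⊆ v (⊆-reflexive (sym (outLabels-insertAt-true w L i))))
  missSem-removeAt-≤ w L i false =
    ⇨-relax (⋀-anti-⊆ v (⊆-reflexive (sym (inLabels-insertAt-false w L i))))
            (⋁-mono-⊆ v (⊆-reflexive-↭ (↭-sym (outLabels-insertAt-false w L i)) ∘ there))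

  pedSem-lowerBound : (d : PED) {z : Zone (PED.n d)} →
                      PED.Z d z ≡ false → pedSem d ≤ missSem z (PED.labels d)
  pedSem-lowerBound d zf = ⋀-lowerBound (λ z → missSem z (PED.labels d)) (∈-missing⁺ d zf)

  pedSem-greatest : (d : PED) {x : Carrier} →
                    (∀ {z} → PED.Z d z ≡ false → x ≤ missSem z (PED.labels d)) → x ≤ pedSem d
  pedSem-greatest d h = ⋀-greatest (λ z → missSem z (PED.labels d)) (missing d) (h ∘ ∈-missing⁻ d)

  pedSem-weaken : (d : PED) {Z′ : Zone (PED.n d) → Bool} →
                  (∀ {z} → Z′ z ≡ false → PED.Z d z ≡ false) →
                  pedSem d ≤ pedSem (record d { Z = Z′ })
  pedSem-weaken d {Z′} h = pedSem-greatest (record d { Z = Z′ }) (pedSem-lowerBound d ∘ h)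

  pedSem-∖ : (d : PED) (i : Fin (PED.n d)) → pedSem d ≤ pedSem (d ∖ i)
  pedSem-∖ d@(ped (suc m) L dL Z) i = pedSem-greatest (d ∖ i) λ {w} wf → begin
    pedSem d
      ≤⟨ ∧-greatest (pedSem-lowerBound d (∨-conicalˡ _ _ wf))
                    (pedSem-lowerBound d (∨-conicalʳ _ _ wf)) ⟩
    missSem (insertAt w i true) L ⊓ missSem (insertAt w i false) L
      ≤⟨ missSem-resolve w L i ⟩
    missSem w (removeAt L i)
      ∎

  pedSem-∖-≤-missSem : (d : PED) {z : Zone (PED.n d)} {i : Fin (PED.n d)} →
                       PED.Z d z ≡ false → PED.Z d (adj z i) ≡ false →
                       pedSem (d ∖ i) ≤ missSem z (PED.labels d)
  pedSem-∖-≤-missSem d@(ped (suc m) L dL Z) {z} {i} zf adjf = begin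
    pedSem (d ∖ i)
      ≤⟨ pedSem-lowerBound (d ∖ i) (removeAt-missing {L = L} {dL} {Z} zf adjf) ⟩
    missSem (removeAt z i) (removeAt L i)
      ≤⟨ missSem-removeAt-≤ (removeAt z i) L i (lookup z i) ⟩
    missSem (insertAt (removeAt z i) i (lookup z i)) L
      ≡⟨ cong (λ z′ → missSem z′ L) (insertAt-removeAt z i) ⟩
    missSem z L
      ∎

  _⊨_ : List CD → List CD → Set ℓ₂
  Γ ⊨ Δ = ⋀ (map cdSem Γ) ≤ ⋁ (map cdSem Δ)

  antecedent-replace : ∀ {A : Set} (f : A → CD) xs D Γ Δ →
                       cdSem D ≤ ⋀ (map (cdSem ∘ f) xs) →
                       (map f xs ++ Γ) ⊨ Δ → (D ∷ Γ) ⊨ Δ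
  antecedent-replace f xs D Γ Δ D≤ prem = begin
    cdSem D ⊓ ⋀ (map cdSem Γ)
      ≤⟨ ⋀-++⁺ cdSem (map f xs) (≤-trans (x∧y≤x _ _) D≤xs) (x∧y≤y _ _) ⟩
    ⋀ (map cdSem (map f xs ++ Γ))
      ≤⟨ prem ⟩
    ⋁ (map cdSem Δ)
      ∎
    where
      D≤xs : cdSem D ≤ ⋀ (map cdSem (map f xs))
      D≤xs = subst (λ ys → cdSem D ≤ ⋀ ys) (map-∘ xs) D≤

  succedent-replace : ∀ {A : Set} (f : A → CD) xs E Γ Δ →
                      ⋀ (map (cdSem ∘ f) xs) ≤ cdSem E →
                      (∀ {x} → x ∈ xs → Γ ⊨ (Δ ∷ʳ f x)) → Γ ⊨ (Δ ∷ʳ E)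
  succedent-replace f xs E Γ Δ ≤E prem = begin
    ⋀ (map cdSem Γ)
      ≤⟨ ⊔-⋀-greatest (cdSem ∘ f) xs (λ x∈ → ≤-trans (prem x∈) (⋁-∷ʳ-≤ cdSem Δ)) ⟩
    ⋁ (map cdSem Δ) ⊔ ⋀ (map (cdSem ∘ f) xs)
      ≤⟨ ∨-monotonic ≤-refl ≤E ⟩
    ⋁ (map cdSem Δ) ⊔ cdSem E
      ≤⟨ ⋁-∷ʳ-≥ cdSem Δ ⟩
    ⋁ (map cdSem (Δ ∷ʳ E))
      ∎

  redL-sound : (d : PED) (cs : List (Fin (PED.n d))) (Γ Δ : List CD) →
               (map (λ i → ⌜ d ∖ i ⌝) cs ++ Γ) ⊨ Δ → (⌜ d ⌝ ∷ Γ) ⊨ Δ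
  redL-sound d cs Γ Δ =
    antecedent-replace (λ i → ⌜ d ∖ i ⌝) cs ⌜ d ⌝ Γ Δ (⋀-greatest _ cs (λ _ → pedSem-∖ d _))

  redR-sound : (d : PED) (cs : List (Fin (PED.n d))) (Γ Δ : List CD) →
               (∀ z → PED.Z d z ≡ false → Σ (Fin (PED.n d)) (λ l → PED.Z d (adj z l) ≡ false)) →
               (∀ {i} → missing (d ∖ i) ≢ [] → i ∈ cs) →
               (∀ {i} → i ∈ cs → Γ ⊨ (Δ ∷ʳ ⌜ d ∖ i ⌝)) → Γ ⊨ (Δ ∷ʳ ⌜ d ⌝)
  redR-sound d cs Γ Δ adjacent complete =
    succedent-replace (λ i → ⌜ d ∖ i ⌝) cs ⌜ d ⌝ Γ Δ (pedSem-greatest d covered)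
    where
      covered : ∀ {z} → PED.Z d z ≡ false →
                ⋀ (map (λ i → pedSem (d ∖ i)) cs) ≤ missSem z (PED.labels d)
      covered {z} zf with adjacent z zf
      ... | l , adjf = ≤-trans (⋀-lowerBound _ (complete (missing-∖-nonempty d zf adjf)))
                               (pedSem-∖-≤-missSem d zf adjf)

  msepL-sound : (d : PED) (Z₁ Z₂ : Zone (PED.n d) → Bool) (Γ Δ : List CD) →
                (∀ z → PED.Z d z ≡ (Z₁ z ∧ Z₂ z)) →
                (⌜ record d { Z = Z₁ } ⌝ ∷ ⌜ record d { Z = Z₂ } ⌝ ∷ Γ) ⊨ Δ →
                (⌜ d ⌝ ∷ Γ) ⊨ Δ
  msepL-sound d Z₁ Z₂ Γ Δ hZ =
    antecedent-replace (λ Z′ → ⌜ record d { Z = Z′ } ⌝) (Z₁ ∷ Z₂ ∷ []) ⌜ d ⌝ Γ Δ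
      (⋀-greatest _ (Z₁ ∷ Z₂ ∷ []) λ
        { (here refl)         → pedSem-weaken d (λ {z} e → trans (hZ z) (cong (_∧ Z₂ z) e))
        ; (there (here refl)) → pedSem-weaken d (λ {z} e → trans (hZ z) (trans (cong (Z₁ z ∧_) e) (∧-zeroʳ _)))
        })

  msepR-sound : (d : PED) (Z₁ Z₂ : Zone (PED.n d) → Bool) (Γ Δ : List CD) →
                (∀ z → PED.Z d z ≡ (Z₁ z ∧ Z₂ z)) →
                Γ ⊨ (Δ ∷ʳ ⌜ record d { Z = Z₁ } ⌝) → Γ ⊨ (Δ ∷ʳ ⌜ record d { Z = Z₂ } ⌝) →
                Γ ⊨ (Δ ∷ʳ ⌜ d ⌝)
  msepR-sound d Z₁ Z₂ Γ Δ hZ prem₁ prem₂ =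
    succedent-replace (λ Z′ → ⌜ record d { Z = Z′ } ⌝) (Z₁ ∷ Z₂ ∷ []) ⌜ d ⌝ Γ Δ
      (pedSem-greatest d covered) λ { (here refl) → prem₁ ; (there (here refl)) → prem₂ }
    where
      covered : ∀ {z} → PED.Z d z ≡ false →
                pedSem (record d { Z = Z₁ }) ⊓ (pedSem (record d { Z = Z₂ }) ⊓ ⊤) ≤
                  missSem z (PED.labels d)
      covered {z} zf with ∧≡false⇒ (trans (sym (hZ z)) zf)
      ... | inj₁ e = ≤-trans (x∧y≤x _ _) (pedSem-lowerBound (record d { Z = Z₁ }) e)
      ... | inj₂ e = ≤-trans (x∧y≤y _ _) (≤-trans (x∧y≤x _ _) (pedSem-lowerBound (record d { Z = Z₂ }) e))

  impDecL-sound : (d : PED) (z : Zone (PED.n d)) (Γ Δ : List CD) → PED.Z d z ≡ false →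
                  (∀ {c} → c ∈ inLabels z (PED.labels d) → (⌜ d ⌝ ∷ Γ) ⊨ [ lit c ]) →
                  (∀ {c} → c ∈ outLabels z (PED.labels d) → (lit c ∷ Γ) ⊨ Δ) →
                  (⌜ d ⌝ ∷ Γ) ⊨ Δ
  impDecL-sound d z Γ Δ zf premIn premOut = begin
    pedSem d ⊓ G
      ≤⟨ ∧-greatest (∧-greatest (≤-trans (x∧y≤x _ _) (pedSem-lowerBound d zf)) allIn) (x∧y≤y _ _) ⟩
    ((In ⇨ Out) ⊓ In) ⊓ G
      ≤⟨ ∧-monotonic ⇨-eval ≤-refl ⟩
    Out ⊓ G
      ≤⟨ ∧-monotonic someOut ≤-refl ⟩
    (G ⇨ R) ⊓ G
      ≤⟨ ⇨-eval ⟩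
    R
      ∎
    where
      G   = ⋀ (map cdSem Γ)
      R   = ⋁ (map cdSem Δ)
      In  = ⋀ (map v (inLabels z (PED.labels d)))
      Out = ⋁ (map v (outLabels z (PED.labels d)))
      allIn : pedSem d ⊓ G ≤ In
      allIn = ⋀-greatest v _ (λ c∈ → ≤-trans (premIn c∈) (∨-least (lit-≤ _) (minimum _)))
      someOut : Out ≤ G ⇨ R
      someOut = ⋁-least v _ λ c∈ →
        transpose-⇨ (≤-trans (∧-monotonic (lit-≥ _) ≤-refl) (premOut c∈))

  impDecR-sound : (d : PED) (z : Zone (PED.n d)) (Γ Δ : List CD) →
                  (∀ {z′} → PED.Z d z′ ≡ false → z′ ≡ z) →
                  (Γ ++ map lit (inLabels z (PED.labels d))) ⊨ map lit (outLabels z (PED.labels d)) →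
                  Γ ⊨ (Δ ∷ʳ ⌜ d ⌝)
  impDecR-sound d z Γ Δ only prem = begin
    G
      ≤⟨ pedSem-greatest d (λ z′f → subst (λ z′ → G ≤ missSem z′ L) (sym (only z′f)) G≤missSem) ⟩
    pedSem d
      ≤⟨ ⋁-upperBound cdSem (∈-++⁺ʳ Δ (here refl)) ⟩
    ⋁ (map cdSem (Δ ∷ʳ ⌜ d ⌝))
      ∎
    where
      G = ⋀ (map cdSem Γ)
      L = PED.labels d
      G≤missSem : G ≤ missSem z L
      G≤missSem = transpose-⇨ (begin
        G ⊓ ⋀ (map v (inLabels z L))
          ≤⟨ ⋀-++⁺ cdSem Γ (x∧y≤x _ _) (≤-trans (x∧y≤y _ _) (⋀-lits-≥ (inLabels z L))) ⟩
        ⋀ (map cdSem (Γ ++ map lit (inLabels z L)))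
          ≤⟨ prem ⟩
        ⋁ (map cdSem (map lit (outLabels z L)))
          ≤⟨ ⋁-lits-≤ (outLabels z L) ⟩
        ⋁ (map v (outLabels z L))
          ∎)

lemma8 : ∀ {a ℓ₁ ℓ₂ : Level} →
  -- (RedL)
  ( (d : PED) (cs : List (Fin (PED.n d))) (Γ Δ : List CD) →
    (∀ z → PED.Z d z ≡ false → Σ (Fin (PED.n d)) (λ l → PED.Z d (adj z l) ≡ false)) →
    Unique cs →
    (∀ i → (i ∈ cs) ⇔ (missing (d ∖ i) ≢ [])) →
    Valid a ℓ₁ ℓ₂ (map (λ i → ⌜ d ∖ i ⌝) cs ++ Γ) Δ →
    Valid a ℓ₁ ℓ₂ (⌜ d ⌝ ∷ Γ) Δ )
  ×
  -- (RedR)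
  ( (d : PED) (cs : List (Fin (PED.n d))) (Γ Δ : List CD) →
    (∀ z → PED.Z d z ≡ false → Σ (Fin (PED.n d)) (λ l → PED.Z d (adj z l) ≡ false)) →
    Unique cs →
    (∀ i → (i ∈ cs) ⇔ (missing (d ∖ i) ≢ [])) →
    (∀ i → i ∈ cs → Valid a ℓ₁ ℓ₂ Γ (Δ ++ [ ⌜ d ∖ i ⌝ ])) →
    Valid a ℓ₁ ℓ₂ Γ (Δ ++ [ ⌜ d ⌝ ]) )
  ×
  -- (MSepL)
  ( (d : PED) (Z₁ Z₂ : Zone (PED.n d) → Bool) (Γ Δ : List CD) →
    1 < length (missing d) →
    (∀ z → PED.Z d z ≡ (Z₁ z ∧ Z₂ z)) →
    Valid a ℓ₁ ℓ₂ (⌜ record d { Z = Z₁ } ⌝ ∷ ⌜ record d { Z = Z₂ } ⌝ ∷ Γ) Δ →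
    Valid a ℓ₁ ℓ₂ (⌜ d ⌝ ∷ Γ) Δ )
  ×
  -- (MSepR)
  ( (d : PED) (Z₁ Z₂ : Zone (PED.n d) → Bool) (Γ Δ : List CD) →
    1 < length (missing d) →
    (∀ z → PED.Z d z ≡ (Z₁ z ∧ Z₂ z)) →
    Valid a ℓ₁ ℓ₂ Γ (Δ ++ [ ⌜ record d { Z = Z₁ } ⌝ ]) →
    Valid a ℓ₁ ℓ₂ Γ (Δ ++ [ ⌜ record d { Z = Z₂ } ⌝ ]) →
    Valid a ℓ₁ ℓ₂ Γ (Δ ++ [ ⌜ d ⌝ ]) )
  ×
  -- (ImpDecL)
  ( (d : PED) (z : Zone (PED.n d)) (Γ Δ : List CD) →
    (∀ z′ → (PED.Z d z′ ≡ false) ⇔ (z′ ≡ z)) →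
    (∀ c → c ∈ inLabels z (PED.labels d) → Valid a ℓ₁ ℓ₂ (⌜ d ⌝ ∷ Γ) [ lit c ]) →
    (∀ c → c ∈ outLabels z (PED.labels d) → Valid a ℓ₁ ℓ₂ (lit c ∷ Γ) Δ) →
    Valid a ℓ₁ ℓ₂ (⌜ d ⌝ ∷ Γ) Δ )
  ×
  -- (ImpDecR)
  ( (d : PED) (z : Zone (PED.n d)) (Γ Δ : List CD) →
    (∀ z′ → (PED.Z d z′ ≡ false) ⇔ (z′ ≡ z)) →
    Valid a ℓ₁ ℓ₂ (Γ ++ map lit (inLabels z (PED.labels d)))
                  (map lit (outLabels z (PED.labels d))) →
    Valid a ℓ₁ ℓ₂ Γ (Δ ++ [ ⌜ d ⌝ ]) )
lemma8 =
  (λ d cs Γ Δ _ _ _ prem H v → redL-sound H v d cs Γ Δ (prem H v)) ,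
  (λ d cs Γ Δ adjacent _ cs-complete prem H v →
     redR-sound H v d cs Γ Δ adjacent (Equivalence.from (cs-complete _)) (λ i∈ → prem _ i∈ H v)) ,
  (λ d Z₁ Z₂ Γ Δ _ hZ prem H v → msepL-sound H v d Z₁ Z₂ Γ Δ hZ (prem H v)) ,
  (λ d Z₁ Z₂ Γ Δ _ hZ prem₁ prem₂ H v → msepR-sound H v d Z₁ Z₂ Γ Δ hZ (prem₁ H v) (prem₂ H v)) ,
  (λ d z Γ Δ only premIn premOut H v →
     impDecL-sound H v d z Γ Δ (Equivalence.from (only z) refl)
       (λ c∈ → premIn _ c∈ H v) (λ c∈ → premOut _ c∈ H v)) ,
  (λ d z Γ Δ only prem H v → impDecR-sound H v d z Γ Δ (Equivalence.to (only _)) (prem H v))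
  where open Soundness
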